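{- Let $n\geq 2$ and $m\geq 1$. The number of set-valued standard Young tableaux $T\in\bigsqcup_{b\geq1,\,k\geq 0,\,2b+k=n}\mathrm{SYT}^{+k}(2\times b)$ whose top row contains exactly $m$ entries in total (counted over all cells of the top row) equals $\frac{1}{m}\binom{n-1}{m-1}\binom{n-2}{m-1}$.
   Context: For a partition $\lambda$ of $N$ (Ferrers diagram in English convention) and $k\geq 0$, $\mathrm{SYT}^{+k}(\lambda)$ is the set of fillings $S$ of the cells of $\lambda$ by nonempty sets of positive integers such that the sets form a set partition of $[N+k]$, and whenever $u\neq v$ are cells with $u$ weakly north and weakly west of $v$, $\max S(u)<\min S(v)$. The shape $2\times b$ has two rows of $b$ cells each. -}

module Defs where

open import Data.Nat using (ℕ; zero; suc; _+_; _*_; _≤_; _<_; _≤?_; _<?_)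
import Data.Nat.Properties as ℕP
open import Data.Fin using (Fin; toℕ)
import Data.Fin as F
import Data.Fin.Properties as FP
open import Data.Product using (_×_; _,_; proj₁; proj₂; ∃)
open import Data.Product.Properties using (≡-dec)
open import Data.Product.Relation.Binary.Pointwise.NonDependent using ()
open import Data.Nat.ListAction using (sum)
open import Data.List using (List; []; _∷_; map; concatMap; filter; length; upTo; cartesianProduct; allFin)
open import Data.Vec using (Vec; lookup; toList) renaming ([] to []ᵥ; _∷_ to _∷ᵥ_)
open import Relation.Binary.PropositionalEquality using (_≡_; _≢_)
open import Relation.Nullary using (Dec; yes; no; ¬_)
open import Relation.Nullary.Decidable using (_×-dec_; _→-dec_; ¬?)

-- A cell of the 2 × b Ferrers diagram: (row , column), rows/columns 0-indexed,
-- row 0 = top row (English convention).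
Cell : ℕ → Set
Cell b = Fin 2 × Fin b

WeaklyNW : ∀ {b} → Cell b → Cell b → Set
WeaklyNW (r , c) (r' , c') = (toℕ r ≤ toℕ r') × (toℕ c ≤ toℕ c')

-- A filling S of 2 × b by sets forming a set partition of [n] (n = N + k)
-- is encoded by the map  i ↦ (the cell whose set contains i+1),
-- i.e. a vector  T : Vec (Cell b) n  with  S(u) = { i+1 | lookup T i ≡ u }.
IsSetValuedSYT : ∀ b n → Vec (Cell b) n → Set
IsSetValuedSYT b n T =
  ((u : Cell b) → ∃ λ (i : Fin n) → lookup T i ≡ u) ×
  ((i j : Fin n) → WeaklyNW (lookup T i) (lookup T j) → lookup T i ≢ lookup T j → toℕ i < toℕ j)

cellDec : ∀ {b} (u v : Cell b) → Dec (u ≡ v)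
cellDec = ≡-dec F._≟_ F._≟_

weaklyNW? : ∀ {b} (u v : Cell b) → Dec (WeaklyNW u v)
weaklyNW? (r , c) (r' , c') = (toℕ r ≤? toℕ r') ×-dec (toℕ c ≤? toℕ c')

isSetValuedSYT? : ∀ b n (T : Vec (Cell b) n) → Dec (IsSetValuedSYT b n T)
isSetValuedSYT? b n T = surj? ×-dec order?
  where
  surj? : Dec ((u : Cell b) → ∃ λ (i : Fin n) → lookup T i ≡ u)
  surj? with FP.all? (λ r → FP.all? (λ c → FP.any? (λ i → cellDec (lookup T i) (r , c))))
  ... | yes p = yes (λ { (r , c) → p r c })
  ... | no ¬p = no (λ q → ¬p (λ r c → q (r , c)))
  order? : Dec ((i j : Fin n) → WeaklyNW (lookup T i) (lookup T j) → lookup T i ≢ lookup T j → toℕ i < toℕ j)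
  order? = FP.all? (λ i → FP.all? (λ j →
             weaklyNW? (lookup T i) (lookup T j) →-dec
               (¬? (cellDec (lookup T i) (lookup T j)) →-dec (toℕ i <? toℕ j))))

allVecs : ∀ {A : Set} → List A → (n : ℕ) → List (Vec A n)
allVecs xs zero = []ᵥ ∷ []
allVecs xs (suc n) = concatMap (λ x → map (x ∷ᵥ_) (allVecs xs n)) xs

allCells : (b : ℕ) → List (Cell b)
allCells b = cartesianProduct (allFin 2) (allFin b)

topRowSize : ∀ {b n} → Vec (Cell b) n → ℕ
topRowSize T = length (filter (λ u → proj₁ u F.≟ F.zero) (toList T))

countShape : (b n m : ℕ) → ℕ
countShape b n m =
  length (filter (λ T → isSetValuedSYT? b n T ×-dec (topRowSize T ℕP.≟ m)) (allVecs (allCells b) n))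

countAll : (n m : ℕ) → ℕ
countAll n m = sum (map (λ b → countShape b n m) (filter (λ b → 2 * b ≤? n) (map suc (upTo n))))

-- Read the entries 1, 2, …, n in increasing order.  Each entry either opens the next cell of its
-- row or joins the last opened one, so a set-valued tableau of shape 2 × b is a word accepted by
-- an automaton whose state (p , q) records how many cells of each row are opened.  Summed over
-- the width b, the number of accepted words becomes a count of lattice walks that no longer
-- involves b: it depends only on the lead h = p − q of the top row and on whether the bottom
-- row has been started.  These walk counts obey Pascal-type recurrences whose solutions are
-- 2 × 2 determinants of binomial coefficients (Lindström–Gessel–Viennot): for n = l + 2 and
-- m = j + 1 the count is C(l,j) C(l+1,j+1) − C(l+1,j) C(l,j+1), and the absorption identities
-- for binomials turn (j + 1) times this into C(l+1,j) C(l,j).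

module Submission where

module BoolReflection where

  open import Data.Nat using (_≤_; _<_; _≡ᵇ_; _<ᵇ_)
  open import Data.Nat.Properties using (≡ᵇ⇒≡; ≡⇒≡ᵇ; <ᵇ⇒<; <⇒<ᵇ; ≮⇒≥)
  open import Data.Bool using (true; false; T)
  open import Data.Unit using (tt)
  open import Relation.Binary.PropositionalEquality using (_≡_; _≢_; refl; subst; sym)
  open import Relation.Nullary using (¬_)
  open import Data.Empty using (⊥-elim)

  private
    T-true : ∀ {x} → x ≡ true → T x
    T-true e = subst T (sym e) tt

    ¬T-false : ∀ {x} → x ≡ false → ¬ T x
    ¬T-false e t = subst T e t

  ≡ᵇ≡true⇒≡ : ∀ m n → (m ≡ᵇ n) ≡ true → m ≡ n
  ≡ᵇ≡true⇒≡ m n e = ≡ᵇ⇒≡ m n (T-true e)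

  ≡ᵇ≡false⇒≢ : ∀ m n → (m ≡ᵇ n) ≡ false → m ≢ n
  ≡ᵇ≡false⇒≢ m n e m≡n = ¬T-false e (≡⇒≡ᵇ m n m≡n)

  <ᵇ≡true⇒< : ∀ m n → (m <ᵇ n) ≡ true → m < n
  <ᵇ≡true⇒< m n e = <ᵇ⇒< m n (T-true e)

  <ᵇ≡false⇒≥ : ∀ m n → (m <ᵇ n) ≡ false → n ≤ m
  <ᵇ≡false⇒≥ m n e = ≮⇒≥ (λ m<n → ¬T-false e (<⇒<ᵇ m<n))

  ≢⇒≡ᵇ≡false : ∀ m n → m ≢ n → (m ≡ᵇ n) ≡ false
  ≢⇒≡ᵇ≡false m n m≢n with m ≡ᵇ n in e
  ... | true  = ⊥-elim (m≢n (≡ᵇ≡true⇒≡ m n e))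
  ... | false = refl

  <⇒<ᵇ≡true : ∀ {m n} → m < n → (m <ᵇ n) ≡ true
  <⇒<ᵇ≡true {m} {n} m<n with m <ᵇ n in e
  ... | true  = refl
  ... | false = ⊥-elim (¬T-false e (<⇒<ᵇ m<n))

module Automaton where

  open import Defs
  open import Data.Nat using (ℕ; zero; suc; _≤_; _<_; z≤n; s≤s; _≡ᵇ_; _<ᵇ_)
  import Data.Nat.Properties as ℕP
  open import Data.Fin as F using (Fin; toℕ; fromℕ<)
  import Data.Fin.Properties as FP
  open import Data.Bool using (Bool; true; false; _∧_; T; if_then_else_)
  open import Data.Bool.Properties using (T-∧)
  open import Data.Empty using (⊥-elim)
  open import Data.Product using (_×_; _,_; proj₁; proj₂; ∃)
  open import Data.Sum using (_⊎_; inj₁; inj₂)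
  open import Data.Vec using (Vec; lookup) renaming ([] to []ᵥ; _∷_ to _∷ᵥ_)
  open import Function using (_⇔_; mk⇔; Equivalence)
  open import Function.Properties.Equivalence using () renaming (trans to ⇔-trans)
  open import Relation.Binary.PropositionalEquality
  open import Relation.Nullary using (¬_; yes; no)
  open import Relation.Binary.Definitions using (tri<; tri≈; tri>)
  open BoolReflection

  pattern top    = F.zero
  pattern bottom = F.suc F.zero

  -- In state (p , q) the entries read so far fill exactly the first p cells of the top row and
  -- the first q cells of the bottom row.  The next entry either opens the next cell of its row or
  -- joins the last filled one; a top cell can be joined only while the cell below it is empty, and
  -- a bottom cell opened only below a filled one.
  accepts : ∀ b → ℕ → ℕ → ∀ {n} → Vec (Cell b) n → Bool
  accepts b p q []ᵥ = (b ≡ᵇ p) ∧ (b ≡ᵇ q)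
  accepts b p q ((top , c) ∷ᵥ w) =
    if toℕ c ≡ᵇ p then accepts b (suc p) q w
    else if (suc (toℕ c) ≡ᵇ p) ∧ (q <ᵇ p) then accepts b p q w
    else false
  accepts b p q ((bottom , c) ∷ᵥ w) =
    if (toℕ c ≡ᵇ q) ∧ (q <ᵇ p) then accepts b p (suc q) w
    else if suc (toℕ c) ≡ᵇ q then accepts b p q w
    else false

  filled : ℕ → ℕ → Fin 2 → ℕ
  filled p q top    = p
  filled p q bottom = q

  Filled : ∀ {b} → ℕ → ℕ → Cell b → Set
  Filled p q (r , c) = toℕ c < filled p q r

  Ordered : ∀ {b n} → Vec (Cell b) n → Set
  Ordered {n = n} w =
    (i j : Fin n) → WeaklyNW (lookup w i) (lookup w j) → lookup w i ≢ lookup w j → toℕ i < toℕ j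

  AfterFilled : ∀ {b n} → ℕ → ℕ → Vec (Cell b) n → Set
  AfterFilled {b} {n} p q w =
    (i : Fin n) (u : Cell b) → Filled p q u → WeaklyNW (lookup w i) u → lookup w i ≡ u

  CoversEmpty : ∀ {b n} → ℕ → ℕ → Vec (Cell b) n → Set
  CoversEmpty {b} {n} p q w = (u : Cell b) → Filled p q u ⊎ ∃ λ (i : Fin n) → lookup w i ≡ u

  -- w is a valid continuation of a tableau filling exactly the cells of state (p , q).
  Completes : ∀ {b n} → ℕ → ℕ → Vec (Cell b) n → Set
  Completes p q w = Ordered w × AfterFilled p q w × CoversEmpty p q w

  ordered-tail : ∀ {b n} {x : Cell b} {w : Vec (Cell b) n} → Ordered (x ∷ᵥ w) → Ordered w
  ordered-tail o i j nw ne = ℕP.≤-pred (o (F.suc i) (F.suc j) nw ne)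

  ordered-head : ∀ {b n} {x : Cell b} {w : Vec (Cell b) n} → Ordered (x ∷ᵥ w) →
    ∀ i → WeaklyNW (lookup w i) x → lookup w i ≡ x
  ordered-head {x = x} {w} o i nw with cellDec (lookup w i) x
  ... | yes e  = e
  ... | no  ne = ⊥-elim (ℕP.n≮0 (o (F.suc i) F.zero nw ne))

  ordered-∷ : ∀ {b n} {x : Cell b} {w : Vec (Cell b) n} → Ordered w →
    (∀ i → WeaklyNW (lookup w i) x → lookup w i ≡ x) → Ordered (x ∷ᵥ w)
  ordered-∷ o h F.zero    F.zero    nw ne = ⊥-elim (ne refl)
  ordered-∷ o h F.zero    (F.suc j) nw ne = s≤s z≤n
  ordered-∷ o h (F.suc i) F.zero    nw ne = ⊥-elim (ne (h i nw))
  ordered-∷ o h (F.suc i) (F.suc j) nw ne = s≤s (o i j nw ne)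

  completes-∷⇔ : ∀ {b n} (x : Cell b) (w : Vec (Cell b) n) {p q p′ q′} →
    (∀ u → Filled p′ q′ u → Filled p q u ⊎ u ≡ x) → (∀ u → Filled p q u → Filled p′ q′ u) →
    Filled p′ q′ x → (∀ u → Filled p q u → WeaklyNW x u → x ≡ u) →
    Completes p q (x ∷ᵥ w) ⇔ Completes p′ q′ w
  completes-∷⇔ x w {p} {q} {p′} {q′} new old x-filled x-after = mk⇔ to from
    where
    to : Completes p q (x ∷ᵥ w) → Completes p′ q′ w
    to (o , a , cv) = ordered-tail o , a′ , cv′
      where
      a′ : AfterFilled p′ q′ w
      a′ i u f nw with new u f
      ... | inj₁ f₀   = a (F.suc i) u f₀ nw
      ... | inj₂ refl = ordered-head o i nw
      cv′ : CoversEmpty p′ q′ w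
      cv′ u with cv u
      ... | inj₁ f                = inj₁ (old u f)
      ... | inj₂ (F.zero , refl)  = inj₁ x-filled
      ... | inj₂ (F.suc i , e)    = inj₂ (i , e)
    from : Completes p′ q′ w → Completes p q (x ∷ᵥ w)
    from (o , a , cv) = ordered-∷ o (λ i nw → a i x x-filled nw) , a′ , cv′
      where
      a′ : AfterFilled p q (x ∷ᵥ w)
      a′ F.zero    u f nw = x-after u f nw
      a′ (F.suc i) u f nw = a i u (old u f) nw
      cv′ : CoversEmpty p q (x ∷ᵥ w)
      cv′ u with cv u
      ... | inj₂ (i , e) = inj₂ (F.suc i , e)
      ... | inj₁ f with new u f
      ...   | inj₁ f₀ = inj₁ f₀
      ...   | inj₂ e  = inj₂ (F.zero , sym e)

  ¬completes-∷-NW-of-filled : ∀ {b n p q} {x : Cell b} {w : Vec (Cell b) n} (u : Cell b) →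
    Filled p q u → WeaklyNW x u → x ≢ u → ¬ Completes p q (x ∷ᵥ w)
  ¬completes-∷-NW-of-filled u f nw ne (o , a , cv) = ne (a F.zero u f nw)

  ¬completes-∷-SE-of-empty : ∀ {b n p q} {x : Cell b} {w : Vec (Cell b) n} (u : Cell b) →
    ¬ Filled p q u → WeaklyNW u x → u ≢ x → ¬ Completes p q (x ∷ᵥ w)
  ¬completes-∷-SE-of-empty u nf nw ne (o , a , cv) with cv u
  ... | inj₁ f              = nf f
  ... | inj₂ (F.zero , e)   = ne (sym e)
  ... | inj₂ (F.suc i , e)  = ne (trans (sym e) (ordered-head o i (subst (λ t → WeaklyNW t _) (sym e) nw)))

  open-top : ∀ {b n p q} {c : Fin b} {w : Vec (Cell b) n} → q ≤ p → toℕ c ≡ p →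
    Completes p q ((top , c) ∷ᵥ w) ⇔ Completes (suc p) q w
  open-top {p = p} {q} {c} {w} q≤p c≡p = completes-∷⇔ _ w new old (s≤s (ℕP.≤-reflexive c≡p)) after
    where
    new : ∀ u → Filled (suc p) q u → Filled p q u ⊎ u ≡ (top , c)
    new (top , c′) f with ℕP.m<1+n⇒m<n∨m≡n f
    ... | inj₁ c′<p = inj₁ c′<p
    ... | inj₂ c′≡p = inj₂ (cong (top ,_) (FP.toℕ-injective (trans c′≡p (sym c≡p))))
    new (bottom , c′) f = inj₁ f
    old : ∀ u → Filled p q u → Filled (suc p) q u
    old (top    , c′) f = ℕP.m<n⇒m<1+n f
    old (bottom , c′) f = f
    after : ∀ u → Filled p q u → WeaklyNW (top , c) u → (top , c) ≡ u
    after (top    , c′) f (_ , c≤c′) = ⊥-elim (ℕP.<⇒≱ f (subst (_≤ toℕ c′) c≡p c≤c′))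
    after (bottom , c′) f (_ , c≤c′) =
      ⊥-elim (ℕP.<⇒≱ (ℕP.<-≤-trans f q≤p) (subst (_≤ toℕ c′) c≡p c≤c′))

  join-top : ∀ {b n p q} {c : Fin b} {w : Vec (Cell b) n} → q < p → suc (toℕ c) ≡ p →
    Completes p q ((top , c) ∷ᵥ w) ⇔ Completes p q w
  join-top {p = p} {q} {c} {w} q<p 1+c≡p =
    completes-∷⇔ _ w (λ u f → inj₁ f) (λ u f → f) (ℕP.≤-reflexive 1+c≡p) after
    where
    c′<p⇒c′≤c : ∀ {c′} → c′ < p → c′ ≤ toℕ c
    c′<p⇒c′≤c c′<p = ℕP.≤-pred (subst (_ <_) (sym 1+c≡p) c′<p)
    after : ∀ u → Filled p q u → WeaklyNW (top , c) u → (top , c) ≡ u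
    after (top    , c′) f (_ , c≤c′) =
      cong (top ,_) (FP.toℕ-injective (ℕP.≤-antisym c≤c′ (c′<p⇒c′≤c f)))
    after (bottom , c′) f (_ , c≤c′) =
      ⊥-elim (ℕP.<⇒≱ f (ℕP.≤-trans (c′<p⇒c′≤c q<p) c≤c′))

  open-bottom : ∀ {b n p q} {c : Fin b} {w : Vec (Cell b) n} → toℕ c ≡ q →
    Completes p q ((bottom , c) ∷ᵥ w) ⇔ Completes p (suc q) w
  open-bottom {p = p} {q} {c} {w} c≡q = completes-∷⇔ _ w new old (s≤s (ℕP.≤-reflexive c≡q)) after
    where
    new : ∀ u → Filled p (suc q) u → Filled p q u ⊎ u ≡ (bottom , c)
    new (top , c′) f = inj₁ f
    new (bottom , c′) f with ℕP.m<1+n⇒m<n∨m≡n f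
    ... | inj₁ c′<q = inj₁ c′<q
    ... | inj₂ c′≡q = inj₂ (cong (bottom ,_) (FP.toℕ-injective (trans c′≡q (sym c≡q))))
    old : ∀ u → Filled p q u → Filled p (suc q) u
    old (top    , c′) f = f
    old (bottom , c′) f = ℕP.m<n⇒m<1+n f
    after : ∀ u → Filled p q u → WeaklyNW (bottom , c) u → (bottom , c) ≡ u
    after (top    , c′) f (() , _)
    after (bottom , c′) f (_ , c≤c′) = ⊥-elim (ℕP.<⇒≱ f (subst (_≤ toℕ c′) c≡q c≤c′))

  join-bottom : ∀ {b n p q} {c : Fin b} {w : Vec (Cell b) n} → suc (toℕ c) ≡ q →
    Completes p q ((bottom , c) ∷ᵥ w) ⇔ Completes p q w
  join-bottom {p = p} {q} {c} {w} 1+c≡q =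
    completes-∷⇔ _ w (λ u f → inj₁ f) (λ u f → f) (ℕP.≤-reflexive 1+c≡q) after
    where
    after : ∀ u → Filled p q u → WeaklyNW (bottom , c) u → (bottom , c) ≡ u
    after (top    , c′) f (() , _)
    after (bottom , c′) f (_ , c≤c′) = cong (bottom ,_) (FP.toℕ-injective
      (ℕP.≤-antisym c≤c′ (ℕP.≤-pred (subst (_ <_) (sym 1+c≡q) f))))

  ¬completes-top-above-filled : ∀ {b n p q} {c : Fin b} {w : Vec (Cell b) n} → p ≤ q →
    suc (toℕ c) ≡ p → ¬ Completes p q ((top , c) ∷ᵥ w)
  ¬completes-top-above-filled p≤q 1+c≡p =
    ¬completes-∷-NW-of-filled (bottom , _) (ℕP.<-≤-trans (ℕP.≤-reflexive 1+c≡p) p≤q) (z≤n , ℕP.≤-refl) (λ ())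

  ¬completes-bottom-below-empty : ∀ {b n p q} {c : Fin b} {w : Vec (Cell b) n} → p ≤ q →
    toℕ c ≡ q → ¬ Completes p q ((bottom , c) ∷ᵥ w)
  ¬completes-bottom-below-empty p≤q c≡q =
    ¬completes-∷-SE-of-empty (top , _) (ℕP.≤⇒≯ (subst (_ ≤_) (sym c≡q) p≤q)) (z≤n , ℕP.≤-refl) (λ ())

  -- An entry neither opening nor joining the last cell of its row leaves a gap or lands strictly
  -- west of the last filled cell.
  ¬completes-skip : ∀ {b n p q} (r : Fin 2) {c : Fin b} {w : Vec (Cell b) n} → filled p q r ≤ b →
    toℕ c ≢ filled p q r → suc (toℕ c) ≢ filled p q r → ¬ Completes p q ((r , c) ∷ᵥ w)
  ¬completes-skip {b} {p = p} {q} r {c} k≤b c≢k 1+c≢k with ℕP.<-cmp (toℕ c) (filled p q r)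
  ... | tri≈ _ c≡k _ = ⊥-elim (c≢k c≡k)
  ... | tri> _ _ k<c =
    ¬completes-∷-SE-of-empty (r , fromℕ< k<b) (ℕP.<-irrefl toℕ-u)
      (ℕP.≤-refl , ℕP.≤-trans (ℕP.≤-reflexive toℕ-u) (ℕP.<⇒≤ k<c))
      (λ u≡x → ℕP.<-irrefl (trans (sym toℕ-u) (cong (λ x → toℕ (proj₂ x)) u≡x)) k<c)
    where
    k<b = ℕP.<-trans k<c (FP.toℕ<n c)
    toℕ-u = FP.toℕ-fromℕ< k<b
  ¬completes-skip {b} {p = p} {q} r {c} k≤b c≢k 1+c≢k | tri< c<k _ _ with filled p q r in k≡
  ... | suc k′ =
    ¬completes-∷-NW-of-filled (r , fromℕ< k≤b)
      (subst₂ _<_ (sym toℕ-u) (sym k≡) ℕP.≤-refl)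
      (ℕP.≤-refl , subst (toℕ c ≤_) (sym toℕ-u) (ℕP.≤-pred c<k))
      (λ x≡u → 1+c≢k (cong suc (trans (cong (λ x → toℕ (proj₂ x)) x≡u) toℕ-u)))
    where
    toℕ-u = FP.toℕ-fromℕ< k≤b

  completes-[]⇔ : ∀ {b p q} → q ≤ p → p ≤ b → Completes p q ([]ᵥ {A = Cell b}) ⇔ T ((b ≡ᵇ p) ∧ (b ≡ᵇ q))
  completes-[]⇔ {b} {p} {q} q≤p p≤b = mk⇔ to from
    where
    full : CoversEmpty p q ([]ᵥ {A = Cell b}) → ∀ r → b ≤ filled p q r
    full cv r = ℕP.≮⇒≥ λ k<b → not-filled k<b (cv (r , fromℕ< k<b))
      where
      not-filled : ∀ k<b → Filled p q (r , fromℕ< k<b) ⊎ ∃ (λ (i : Fin 0) → _) → _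
      not-filled k<b (inj₁ f) = ℕP.<-irrefl (FP.toℕ-fromℕ< k<b) f
      not-filled k<b (inj₂ (() , _))
    to : Completes p q []ᵥ → T ((b ≡ᵇ p) ∧ (b ≡ᵇ q))
    to (_ , _ , cv) = Equivalence.from T-∧
      ( ℕP.≡⇒≡ᵇ b p (ℕP.≤-antisym (full cv top) p≤b)
      , ℕP.≡⇒≡ᵇ b q (ℕP.≤-antisym (full cv bottom) (ℕP.≤-trans q≤p p≤b)))
    from : T ((b ≡ᵇ p) ∧ (b ≡ᵇ q)) → Completes p q []ᵥ
    from t = (λ ()) , (λ ()) , λ { (r , c) → inj₁ (subst (toℕ c <_) (row-full r) (FP.toℕ<n c)) }
      where
      row-full : ∀ r → b ≡ filled p q r
      row-full top    = ℕP.≡ᵇ⇒≡ b p (proj₁ (Equivalence.to T-∧ t))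
      row-full bottom = ℕP.≡ᵇ⇒≡ b q (proj₂ (Equivalence.to (T-∧ {b ≡ᵇ p}) t))

  refute : ∀ {A : Set} → ¬ A → A ⇔ T false
  refute ¬a = mk⇔ ¬a (λ ())

  completes⇔accepts : ∀ {b n p q} (w : Vec (Cell b) n) → q ≤ p → p ≤ b →
    Completes p q w ⇔ T (accepts b p q w)
  completes⇔accepts []ᵥ q≤p p≤b = completes-[]⇔ q≤p p≤b
  completes⇔accepts {b} {p = p} {q} ((top , c) ∷ᵥ w) q≤p p≤b with toℕ c ≡ᵇ p in c≟p
  ... | true = ⇔-trans (open-top q≤p c≡p)
                 (completes⇔accepts w (ℕP.m≤n⇒m≤1+n q≤p) (subst (_< b) c≡p (FP.toℕ<n c)))
    where c≡p = ≡ᵇ≡true⇒≡ _ _ c≟p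
  ... | false with suc (toℕ c) ≡ᵇ p in 1+c≟p | q <ᵇ p in q<?p
  ...   | true  | true  = ⇔-trans (join-top (<ᵇ≡true⇒< q p q<?p) (≡ᵇ≡true⇒≡ _ _ 1+c≟p))
                            (completes⇔accepts w q≤p p≤b)
  ...   | true  | false = refute (¬completes-top-above-filled (<ᵇ≡false⇒≥ q p q<?p) (≡ᵇ≡true⇒≡ _ _ 1+c≟p))
  ...   | false | _     = refute (¬completes-skip top p≤b (≡ᵇ≡false⇒≢ _ _ c≟p) (≡ᵇ≡false⇒≢ _ _ 1+c≟p))
  completes⇔accepts {b} {p = p} {q} ((bottom , c) ∷ᵥ w) q≤p p≤b with toℕ c ≡ᵇ q in c≟q | q <ᵇ p in q<?p
  ... | true | true  = ⇔-trans (open-bottom (≡ᵇ≡true⇒≡ _ _ c≟q))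
                         (completes⇔accepts w (<ᵇ≡true⇒< q p q<?p) p≤b)
  ... | true | false with suc (toℕ c) ≡ᵇ q in 1+c≟q
  ...   | true  = ⊥-elim (ℕP.1+n≢n (trans (≡ᵇ≡true⇒≡ (suc (toℕ c)) q 1+c≟q) (sym (≡ᵇ≡true⇒≡ (toℕ c) q c≟q))))
  ...   | false = refute (¬completes-bottom-below-empty (<ᵇ≡false⇒≥ q p q<?p) (≡ᵇ≡true⇒≡ _ _ c≟q))
  completes⇔accepts {b} {p = p} {q} ((bottom , c) ∷ᵥ w) q≤p p≤b | false | _ with suc (toℕ c) ≡ᵇ q in 1+c≟q
  ...   | true  = ⇔-trans (join-bottom (≡ᵇ≡true⇒≡ _ _ 1+c≟q)) (completes⇔accepts w q≤p p≤b)
  ...   | false = refute (¬completes-skip bottom (ℕP.≤-trans q≤p p≤b) (≡ᵇ≡false⇒≢ _ _ c≟q) (≡ᵇ≡false⇒≢ _ _ 1+c≟q))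

  isSetValuedSYT⇔accepts : ∀ b n (w : Vec (Cell b) n) → IsSetValuedSYT b n w ⇔ T (accepts b 0 0 w)
  isSetValuedSYT⇔accepts b n w = ⇔-trans (mk⇔ to from) (completes⇔accepts w z≤n z≤n)
    where
    nothing-filled : (u : Cell b) → ¬ Filled 0 0 u
    nothing-filled (top    , _) ()
    nothing-filled (bottom , _) ()
    to : IsSetValuedSYT b n w → Completes 0 0 w
    to (covers , ordered) = ordered , (λ _ u f → ⊥-elim (nothing-filled u f)) , (λ u → inj₂ (covers u))
    from : Completes 0 0 w → IsSetValuedSYT b n w
    from (ordered , _ , cv) = covers , ordered
      where
      covers : (u : Cell b) → ∃ λ i → lookup w i ≡ u
      covers u with cv u
      ... | inj₁ f     = ⊥-elim (nothing-filled u f)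
      ... | inj₂ found = found

module Sums where

  open import Data.Nat using (ℕ; zero; suc; _+_; _≤_; _≡ᵇ_; _<ᵇ_)
  open BoolReflection using (<⇒<ᵇ≡true)
  import Data.Nat.Properties as ℕP
  open import Data.Nat.ListAction using (sum)
  open import Data.Nat.ListAction.Properties using (sum-++)
  open import Data.Nat.Tactic.RingSolver using (solve-∀)
  open import Data.Bool using (Bool; true; false; _∧_; if_then_else_)
  open import Data.Fin as F using (Fin; toℕ)
  open import Data.List using (List; []; _∷_; _++_; map; concatMap; filter; length; applyUpTo; tabulate)
  open import Data.List.Properties using (map-++)
  open import Relation.Binary.PropositionalEquality
  open import Relation.Nullary using (¬_; yes; no; does)
  open import Relation.Unary using (Decidable)

  when : Bool → ℕ → ℕ
  when c x = if c then x else 0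

  𝟙 : Bool → ℕ
  𝟙 c = when c 1

  when-cong : ∀ c {X Y} → (c ≡ true → X ≡ Y) → when c X ≡ when c Y
  when-cong true  X≡Y = X≡Y refl
  when-cong false X≡Y = refl

  when-≡0 : ∀ c {X} → X ≡ 0 → when c X ≡ 0
  when-≡0 true  X≡0 = X≡0
  when-≡0 false X≡0 = refl

  when-∧ : ∀ a b X → when (a ∧ b) X ≡ when b (when a X)
  when-∧ true  b     X = refl
  when-∧ false true  X = refl
  when-∧ false false X = refl

  ∑< : ℕ → (ℕ → ℕ) → ℕ
  ∑< K f = sum (applyUpTo f K)

  ∑<-cong : ∀ K {f g : ℕ → ℕ} → (∀ i → f i ≡ g i) → ∑< K f ≡ ∑< K g
  ∑<-cong zero    f≗g = refl
  ∑<-cong (suc K) f≗g = cong₂ _+_ (f≗g 0) (∑<-cong K (λ i → f≗g (suc i)))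

  ∑<-zero : ∀ K {f : ℕ → ℕ} → (∀ i → f i ≡ 0) → ∑< K f ≡ 0
  ∑<-zero K f≗0 = trans (∑<-cong K f≗0) (zeros K)
    where
    zeros : ∀ K → ∑< K (λ _ → 0) ≡ 0
    zeros zero    = refl
    zeros (suc K) = zeros K

  ∑<-+ : ∀ K (f g : ℕ → ℕ) → ∑< K (λ i → f i + g i) ≡ ∑< K f + ∑< K g
  ∑<-+ zero    f g = refl
  ∑<-+ (suc K) f g = trans (cong (f 0 + g 0 +_) (∑<-+ K (λ i → f (suc i)) (λ i → g (suc i))))
                           (interchange (f 0) (g 0) _ _)
    where
    interchange : ∀ a b c d → (a + b) + (c + d) ≡ (a + c) + (b + d)
    interchange = solve-∀

  ∑<-when : ∀ K c (f : ℕ → ℕ) → ∑< K (λ i → when c (f i)) ≡ when c (∑< K f)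
  ∑<-when K true  f = refl
  ∑<-when K false f = ∑<-zero K (λ _ → refl)

  ∑<-when-≡ᵇ : ∀ K x X → ∑< K (λ i → when (i ≡ᵇ x) X) ≡ when (x <ᵇ K) X
  ∑<-when-≡ᵇ zero    x       X = refl
  ∑<-when-≡ᵇ (suc K) zero    X = trans (cong (X +_) (∑<-zero K (λ _ → refl))) (ℕP.+-identityʳ X)
  ∑<-when-≡ᵇ (suc K) (suc x) X = ∑<-when-≡ᵇ K x X

  ∑<-when-suc≡ᵇ : ∀ K x X → x ≤ K → ∑< K (λ i → when (suc i ≡ᵇ x) X) ≡ when (0 <ᵇ x) X
  ∑<-when-suc≡ᵇ K zero    X _ = ∑<-zero K (λ _ → refl)
  ∑<-when-suc≡ᵇ K (suc x) X x<K = trans (∑<-when-≡ᵇ K x X) (cong (λ c → when c X) (<⇒<ᵇ≡true x<K))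

  sum-map-++ : ∀ {A : Set} (f : A → ℕ) xs ys → sum (map f (xs ++ ys)) ≡ sum (map f xs) + sum (map f ys)
  sum-map-++ f xs ys = trans (cong sum (map-++ f xs ys)) (sum-++ (map f xs) (map f ys))

  sum-map-concatMap : ∀ {A B : Set} (f : B → ℕ) (h : A → List B) xs →
    sum (map f (concatMap h xs)) ≡ sum (map (λ x → sum (map f (h x))) xs)
  sum-map-concatMap f h []       = refl
  sum-map-concatMap f h (x ∷ xs) =
    trans (sum-map-++ f (h x) (concatMap h xs)) (cong (sum (map f (h x)) +_) (sum-map-concatMap f h xs))

  sum-zero : ∀ {A : Set} {f : A → ℕ} xs → (∀ x → f x ≡ 0) → sum (map f xs) ≡ 0
  sum-zero []       f≗0 = refl
  sum-zero (x ∷ xs) f≗0 = cong₂ _+_ (f≗0 x) (sum-zero xs f≗0)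

  sum-cong : ∀ {A : Set} {f g : A → ℕ} xs → (∀ x → f x ≡ g x) → sum (map f xs) ≡ sum (map g xs)
  sum-cong []       f≗g = refl
  sum-cong (x ∷ xs) f≗g = cong₂ _+_ (f≗g x) (sum-cong xs f≗g)

  sum-tabulate : ∀ {A : Set} n (f : Fin n → A) (g : A → ℕ) (h : ℕ → ℕ) → (∀ i → g (f i) ≡ h (toℕ i)) →
    sum (map g (tabulate f)) ≡ ∑< n h
  sum-tabulate zero    f g h e = refl
  sum-tabulate (suc n) f g h e =
    cong₂ _+_ (e F.zero) (sum-tabulate n (λ i → f (F.suc i)) g (λ i → h (suc i)) (λ i → e (F.suc i)))

  sum-map-filter : ∀ {A : Set} {P : A → Set} (P? : Decidable P) (f : A → ℕ) xs →
    (∀ x → ¬ P x → f x ≡ 0) → sum (map f (filter P? xs)) ≡ sum (map f xs)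
  sum-map-filter P? f []       f-out = refl
  sum-map-filter P? f (x ∷ xs) f-out with P? x
  ... | yes _  = cong (f x +_) (sum-map-filter P? f xs f-out)
  ... | no ¬px = trans (sum-map-filter P? f xs f-out) (cong (_+ sum (map f xs)) (sym (f-out x ¬px)))

  length-filter≡sum-𝟙 : ∀ {A : Set} {P : A → Set} (P? : Decidable P) xs →
    length (filter P? xs) ≡ sum (map (λ x → 𝟙 (does (P? x))) xs)
  length-filter≡sum-𝟙 P? [] = refl
  length-filter≡sum-𝟙 P? (x ∷ xs) with does (P? x)
  ... | true  = cong suc (length-filter≡sum-𝟙 P? xs)
  ... | false = length-filter≡sum-𝟙 P? xs

module Counting where

  open import Defs
  open Automaton
  open Sums
  open BoolReflection
  open import Data.Nat using (ℕ; zero; suc; _+_; _≤_; z≤n; s≤s; _≡ᵇ_; _<ᵇ_)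
  import Data.Nat.Properties as ℕP
  open import Data.Nat.ListAction using (sum)
  open import Data.Bool using (Bool; true; false; _∧_)
  open import Data.Bool.Properties using (∧-zeroʳ; ∧-identityʳ)
  open import Data.Fin using (toℕ)
  open import Data.List using (List; []; _++_; map; allFin)
  open import Data.List.Properties using (map-∘)
  open import Data.Vec using (Vec) renaming (_∷_ to _∷ᵥ_)
  open import Data.Product using (_,_)
  open import Relation.Binary.PropositionalEquality
  open import Relation.Nullary.Decidable using (_×-dec_; does-⇔; T?)

  shift : (ℕ → ℕ) → ℕ → ℕ
  shift F zero    = 0
  shift F (suc j) = F j

  shift-zero : ∀ {F} j → (∀ j → F j ≡ 0) → shift F j ≡ 0
  shift-zero zero    F≗0 = refl
  shift-zero (suc j) F≗0 = F≗0 j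

  shift-cong : ∀ {F G} j → (∀ j → F j ≡ G j) → shift F j ≡ shift G j
  shift-cong zero    F≗G = refl
  shift-cong (suc j) F≗G = F≗G j

  words : ∀ b L → List (Vec (Cell b) L)
  words b L = allVecs (allCells b) L

  accepted : ∀ b → ℕ → ℕ → ℕ → ℕ → ℕ
  accepted b p q L j = sum (map (λ w → 𝟙 (accepts b p q w ∧ (topRowSize w ≡ᵇ j))) (words b L))

  -- Recursion on the first move: open or join a top cell (using up one of the j top-row
  -- entries), open or join a bottom cell.
  paths : ∀ b → ℕ → ℕ → ℕ → ℕ → ℕ
  paths b p q zero    zero    = 𝟙 ((b ≡ᵇ p) ∧ (b ≡ᵇ q))
  paths b p q zero    (suc j) = 0
  paths b p q (suc L) j =
    (when (p <ᵇ b) (shift (paths b (suc p) q L) j) + when (q <ᵇ p) (shift (paths b p q L) j)) +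
    (when (q <ᵇ p) (paths b p (suc q) L j) + when (0 <ᵇ q) (paths b p q L j))

  countShape≡accepted : ∀ b n m → countShape b n m ≡ accepted b 0 0 n m
  countShape≡accepted b n m =
    trans (length-filter≡sum-𝟙 (λ w → isSetValuedSYT? b n w ×-dec (topRowSize w ℕP.≟ m)) (words b n))
          (sum-cong (words b n) λ w → cong (λ t → 𝟙 (t ∧ (topRowSize w ≡ᵇ m)))
            (does-⇔ (isSetValuedSYT⇔accepts b n w) (isSetValuedSYT? b n w) (T? (accepts b 0 0 w))))

  sum-𝟙-shift : ∀ {A : Set} (a : A → Bool) (t : A → ℕ) xs j →
    sum (map (λ x → 𝟙 (a x ∧ (suc (t x) ≡ᵇ j))) xs) ≡
    shift (λ j′ → sum (map (λ x → 𝟙 (a x ∧ (t x ≡ᵇ j′))) xs)) j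
  sum-𝟙-shift a t xs zero    = sum-zero xs (λ x → cong 𝟙 (∧-zeroʳ (a x)))
  sum-𝟙-shift a t xs (suc j) = refl

  sum-words-suc : ∀ b L (f : ∀ {n} → Vec (Cell b) n → ℕ) →
    sum (map f (words b (suc L))) ≡ sum (map (λ x → sum (map (λ w → f (x ∷ᵥ w)) (words b L))) (allCells b))
  sum-words-suc b L f =
    trans (sum-map-concatMap f (λ x → map (x ∷ᵥ_) (words b L)) (allCells b))
          (sum-cong (allCells b) (λ x → cong sum (sym (map-∘ (words b L)))))

  sum-allCells : ∀ b (g : Cell b → ℕ) (gᵗ gᵇ : ℕ → ℕ) →
    (∀ c → g (top , c) ≡ gᵗ (toℕ c)) → (∀ c → g (bottom , c) ≡ gᵇ (toℕ c)) →
    sum (map g (allCells b)) ≡ ∑< b gᵗ + ∑< b gᵇ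
  sum-allCells b g gᵗ gᵇ top≗ bottom≗ = begin
      sum (map g (map (top ,_) (allFin b) ++ (map (bottom ,_) (allFin b) ++ [])))
    ≡⟨ sum-map-++ g (map (top ,_) (allFin b)) _ ⟩
      sum (map g (map (top ,_) (allFin b))) + sum (map g (map (bottom ,_) (allFin b) ++ []))
    ≡⟨ cong (sum (map g (map (top ,_) (allFin b))) +_)
            (trans (sum-map-++ g (map (bottom ,_) (allFin b)) []) (ℕP.+-identityʳ _)) ⟩
      sum (map g (map (top ,_) (allFin b))) + sum (map g (map (bottom ,_) (allFin b)))
    ≡⟨ cong₂ _+_ (trans (cong sum (sym (map-∘ (allFin b)))) (sum-tabulate b (λ c → c) (λ c → g (top , c)) gᵗ top≗))
                 (trans (cong sum (sym (map-∘ (allFin b)))) (sum-tabulate b (λ c → c) (λ c → g (bottom , c)) gᵇ bottom≗)) ⟩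
      ∑< b gᵗ + ∑< b gᵇ
    ∎
    where open ≡-Reasoning

  module _ (b p q L j : ℕ) where

    after : Cell b → ℕ
    after x = sum (map (λ w → 𝟙 (accepts b p q (x ∷ᵥ w) ∧ (topRowSize (x ∷ᵥ w) ≡ᵇ j))) (words b L))

    after-top : ∀ c → after (top , c) ≡
      when (toℕ c ≡ᵇ p) (shift (accepted b (suc p) q L) j) +
      when ((suc (toℕ c) ≡ᵇ p) ∧ (q <ᵇ p)) (shift (accepted b p q L) j)
    after-top c with toℕ c ≡ᵇ p in c≟p
    ... | true rewrite ≢⇒≡ᵇ≡false (suc (toℕ c)) p (λ e → ℕP.1+n≢n (trans e (sym (≡ᵇ≡true⇒≡ _ _ c≟p)))) =
      trans (sum-𝟙-shift (accepts b (suc p) q) topRowSize (words b L) j) (sym (ℕP.+-identityʳ _))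
    ... | false with (suc (toℕ c) ≡ᵇ p) ∧ (q <ᵇ p)
    ...   | true  = sum-𝟙-shift (accepts b p q) topRowSize (words b L) j
    ...   | false = sum-zero (words b L) (λ _ → refl)

    after-bottom : ∀ c → after (bottom , c) ≡
      when ((toℕ c ≡ᵇ q) ∧ (q <ᵇ p)) (accepted b p (suc q) L j) + when (suc (toℕ c) ≡ᵇ q) (accepted b p q L j)
    after-bottom c with toℕ c ≡ᵇ q in c≟q
    ... | true rewrite ≢⇒≡ᵇ≡false (suc (toℕ c)) q (λ e → ℕP.1+n≢n (trans e (sym (≡ᵇ≡true⇒≡ _ _ c≟q)))) with q <ᵇ p
    ...   | true  = sym (ℕP.+-identityʳ _)
    ...   | false = sum-zero (words b L) (λ _ → refl)
    after-bottom c | false with suc (toℕ c) ≡ᵇ q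
    ...   | true  = refl
    ...   | false = sum-zero (words b L) (λ _ → refl)

    accepted-suc : accepted b p q (suc L) j ≡
      ∑< b (λ c → when (c ≡ᵇ p) (shift (accepted b (suc p) q L) j) +
                  when ((suc c ≡ᵇ p) ∧ (q <ᵇ p)) (shift (accepted b p q L) j)) +
      ∑< b (λ c → when ((c ≡ᵇ q) ∧ (q <ᵇ p)) (accepted b p (suc q) L j) +
                  when (suc c ≡ᵇ q) (accepted b p q L j))
    accepted-suc = trans (sum-words-suc b L (λ w → 𝟙 (accepts b p q w ∧ (topRowSize w ≡ᵇ j))))
                         (sum-allCells b after _ _ after-top after-bottom)

  ∑<-top-moves : ∀ b p q X Y → p ≤ b →
    ∑< b (λ c → when (c ≡ᵇ p) X + when ((suc c ≡ᵇ p) ∧ (q <ᵇ p)) Y) ≡ when (p <ᵇ b) X + when (q <ᵇ p) Y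
  ∑<-top-moves b p q X Y p≤b = begin
      ∑< b (λ c → when (c ≡ᵇ p) X + when ((suc c ≡ᵇ p) ∧ (q <ᵇ p)) Y)
    ≡⟨ ∑<-+ b _ _ ⟩
      ∑< b (λ c → when (c ≡ᵇ p) X) + ∑< b (λ c → when ((suc c ≡ᵇ p) ∧ (q <ᵇ p)) Y)
    ≡⟨ cong (∑< b (λ c → when (c ≡ᵇ p) X) +_) (∑<-cong b (λ c → when-∧ (suc c ≡ᵇ p) (q <ᵇ p) Y)) ⟩
      ∑< b (λ c → when (c ≡ᵇ p) X) + ∑< b (λ c → when (q <ᵇ p) (when (suc c ≡ᵇ p) Y))
    ≡⟨ cong₂ _+_ (∑<-when-≡ᵇ b p X) (∑<-when b (q <ᵇ p) _) ⟩
      when (p <ᵇ b) X + when (q <ᵇ p) (∑< b (λ c → when (suc c ≡ᵇ p) Y))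
    ≡⟨ cong (when (p <ᵇ b) X +_) (when-cong (q <ᵇ p) λ q<?p →
         trans (∑<-when-suc≡ᵇ b p Y p≤b) (cong (λ t → when t Y) (<⇒<ᵇ≡true (ℕP.<-≤-trans (s≤s z≤n) (<ᵇ≡true⇒< q p q<?p))))) ⟩
      when (p <ᵇ b) X + when (q <ᵇ p) Y
    ∎
    where open ≡-Reasoning

  ∑<-bottom-moves : ∀ b p q X Y → q ≤ p → p ≤ b →
    ∑< b (λ c → when ((c ≡ᵇ q) ∧ (q <ᵇ p)) X + when (suc c ≡ᵇ q) Y) ≡ when (q <ᵇ p) X + when (0 <ᵇ q) Y
  ∑<-bottom-moves b p q X Y q≤p p≤b = begin
      ∑< b (λ c → when ((c ≡ᵇ q) ∧ (q <ᵇ p)) X + when (suc c ≡ᵇ q) Y)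
    ≡⟨ ∑<-+ b _ _ ⟩
      ∑< b (λ c → when ((c ≡ᵇ q) ∧ (q <ᵇ p)) X) + ∑< b (λ c → when (suc c ≡ᵇ q) Y)
    ≡⟨ cong₂ _+_ (∑<-cong b (λ c → when-∧ (c ≡ᵇ q) (q <ᵇ p) X)) (∑<-when-suc≡ᵇ b q Y (ℕP.≤-trans q≤p p≤b)) ⟩
      ∑< b (λ c → when (q <ᵇ p) (when (c ≡ᵇ q) X)) + when (0 <ᵇ q) Y
    ≡⟨ cong (_+ when (0 <ᵇ q) Y) (trans (∑<-when b (q <ᵇ p) _) (when-cong (q <ᵇ p) λ q<?p →
         trans (∑<-when-≡ᵇ b q X) (cong (λ t → when t X) (<⇒<ᵇ≡true (ℕP.<-≤-trans (<ᵇ≡true⇒< q p q<?p) p≤b))))) ⟩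
      when (q <ᵇ p) X + when (0 <ᵇ q) Y
    ∎
    where open ≡-Reasoning

  accepted≡paths : ∀ b p q L j → q ≤ p → p ≤ b → accepted b p q L j ≡ paths b p q L j
  accepted≡paths b p q zero zero    _ _ = trans (ℕP.+-identityʳ _) (cong 𝟙 (∧-identityʳ _))
  accepted≡paths b p q zero (suc j) _ _ = trans (ℕP.+-identityʳ _) (cong 𝟙 (∧-zeroʳ _))
  accepted≡paths b p q (suc L) j q≤p p≤b = begin
      accepted b p q (suc L) j
    ≡⟨ accepted-suc b p q L j ⟩
      _
    ≡⟨ cong₂ _+_ (∑<-top-moves b p q _ _ p≤b) (∑<-bottom-moves b p q _ _ q≤p p≤b) ⟩
      (when (p <ᵇ b) (shift (accepted b (suc p) q L) j) + when (q <ᵇ p) (shift (accepted b p q L) j)) +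
      (when (q <ᵇ p) (accepted b p (suc q) L j) + when (0 <ᵇ q) (accepted b p q L j))
    ≡⟨ cong₂ _+_
         (cong₂ _+_
           (when-cong (p <ᵇ b) λ p<?b → shift-cong j λ j′ →
              accepted≡paths b (suc p) q L j′ (ℕP.m≤n⇒m≤1+n q≤p) (<ᵇ≡true⇒< p b p<?b))
           (cong (when (q <ᵇ p)) (shift-cong j λ j′ → accepted≡paths b p q L j′ q≤p p≤b)))
         (cong₂ _+_
           (when-cong (q <ᵇ p) λ q<?p → accepted≡paths b p (suc q) L j (<ᵇ≡true⇒< q p q<?p) p≤b)
           (cong (when (0 <ᵇ q)) (accepted≡paths b p q L j q≤p p≤b))) ⟩
      paths b p q (suc L) j
    ∎
    where open ≡-Reasoning

module Walks where

  open Sums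
  open Counting
  open BoolReflection
  open import Data.Nat using (ℕ; zero; suc; pred; _+_; _≤_; _<_; s≤s; _≡ᵇ_; _<ᵇ_)
  import Data.Nat.Properties as ℕP
  open import Data.Bool using (Bool; true; false; _∧_)
  open import Data.Bool.Properties using (∧-zeroʳ; ∧-idem)
  open import Data.Empty using (⊥-elim)
  open import Relation.Binary.PropositionalEquality

  -- paths with the width summed out: h = p − q is the lead of the top row over the bottom row,
  -- and s records whether the bottom row is nonempty.
  walks : ℕ → Bool → ℕ → ℕ → ℕ
  walks h s zero    zero    = 𝟙 ((h ≡ᵇ 0) ∧ s)
  walks h s zero    (suc j) = 0
  walks h s (suc L) j =
    (shift (walks (suc h) s L) j + when (0 <ᵇ h) (shift (walks h s L) j)) +
    (when (0 <ᵇ h) (walks (pred h) true L j) + when s (walks h s L j))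

  paths-suc≡0 : ∀ b p q L j → (∀ j → paths b (suc p) q L j ≡ 0) → (∀ j → paths b p q L j ≡ 0) →
    (∀ j → paths b p (suc q) L j ≡ 0) → paths b p q (suc L) j ≡ 0
  paths-suc≡0 b p q L j open-top stay open-bottom =
    cong₂ _+_ (cong₂ _+_ (when-≡0 (p <ᵇ b) (shift-zero j open-top)) (when-≡0 (q <ᵇ p) (shift-zero j stay)))
              (cong₂ _+_ (when-≡0 (q <ᵇ p) (open-bottom j)) (when-≡0 (0 <ᵇ q) (stay j)))

  paths-narrow≡0 : ∀ b p q L j → b < p → paths b p q L j ≡ 0
  paths-narrow≡0 b p q zero zero b<p rewrite ≢⇒≡ᵇ≡false b p (ℕP.<⇒≢ b<p) = refl
  paths-narrow≡0 b p q zero (suc j) b<p = refl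
  paths-narrow≡0 b p q (suc L) j b<p = paths-suc≡0 b p q L j
    (λ j → paths-narrow≡0 b (suc p) q L j (ℕP.m<n⇒m<1+n b<p))
    (λ j → paths-narrow≡0 b p q L j b<p)
    (λ j → paths-narrow≡0 b p (suc q) L j b<p)

  -- Each step fills at most one cell, and 2b cells have to be filled.
  paths-short≡0 : ∀ b p q L j → L + (p + q) < b + b → paths b p q L j ≡ 0
  paths-short≡0 b p q zero zero short with b ≡ᵇ p in b≟p | b ≡ᵇ q in b≟q
  ... | true  | true  = ⊥-elim (ℕP.<-irrefl (sym (cong₂ _+_ (≡ᵇ≡true⇒≡ b p b≟p) (≡ᵇ≡true⇒≡ b q b≟q))) short)
  ... | true  | false = refl
  ... | false | _     = refl
  paths-short≡0 b p q zero (suc j) short = refl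
  paths-short≡0 b p q (suc L) j short = paths-suc≡0 b p q L j
    (λ j → paths-short≡0 b (suc p) q L j (subst (_< b + b) (sym (ℕP.+-suc L (p + q))) short))
    (λ j → paths-short≡0 b p q L j (ℕP.<-trans (ℕP.n<1+n _) short))
    (λ j → paths-short≡0 b p (suc q) L j
      (subst (_< b + b) (sym (trans (cong (L +_) (ℕP.+-suc p q)) (ℕP.+-suc L (p + q)))) short))

  ∑<-shift : ∀ K (F : ℕ → ℕ → ℕ) j → ∑< K (λ b → shift (F b) j) ≡ shift (λ j′ → ∑< K (λ b → F b j′)) j
  ∑<-shift K F zero    = ∑<-zero K (λ _ → refl)
  ∑<-shift K F (suc j) = refl

  q<ᵇh+q≡0<ᵇh : ∀ h q → (q <ᵇ h + q) ≡ (0 <ᵇ h)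
  q<ᵇh+q≡0<ᵇh h zero    = cong (0 <ᵇ_) (ℕP.+-identityʳ h)
  q<ᵇh+q≡0<ᵇh h (suc q) = trans (cong (suc q <ᵇ_) (ℕP.+-suc h q)) (q<ᵇh+q≡0<ᵇh h q)

  paths-suc : ∀ b p q L j → paths b p q (suc L) j ≡
    (shift (paths b (suc p) q L) j + when (q <ᵇ p) (shift (paths b p q L) j)) +
    (when (q <ᵇ p) (paths b p (suc q) L j) + when (0 <ᵇ q) (paths b p q L j))
  paths-suc b p q L j = cong (λ t → (t + join-top) + bottom-moves) open-top-unguarded
    where
    join-top = when (q <ᵇ p) (shift (paths b p q L) j)
    bottom-moves = when (q <ᵇ p) (paths b p (suc q) L j) + when (0 <ᵇ q) (paths b p q L j)
    open-top-unguarded : when (p <ᵇ b) (shift (paths b (suc p) q L) j) ≡ shift (paths b (suc p) q L) j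
    open-top-unguarded with p <ᵇ b in p<?b
    ... | true  = refl
    ... | false = sym (shift-zero j λ j → paths-narrow≡0 b (suc p) q L j (s≤s (<ᵇ≡false⇒≥ p b p<?b)))

  ∑<-moves : ∀ K (A B C : ℕ → ℕ → ℕ) c₁ c₂ j →
    ∑< K (λ b → (shift (A b) j + when c₁ (shift (B b) j)) + (when c₁ (C b j) + when c₂ (B b j))) ≡
    (shift (λ j → ∑< K (λ b → A b j)) j + when c₁ (shift (λ j → ∑< K (λ b → B b j)) j)) +
    (when c₁ (∑< K (λ b → C b j)) + when c₂ (∑< K (λ b → B b j)))
  ∑<-moves K A B C c₁ c₂ j = begin
      ∑< K (λ b → (shift (A b) j + when c₁ (shift (B b) j)) + (when c₁ (C b j) + when c₂ (B b j)))
    ≡⟨ trans (∑<-+ K _ _) (cong₂ _+_ (∑<-+ K _ _) (∑<-+ K _ _)) ⟩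
      (∑< K (λ b → shift (A b) j) + ∑< K (λ b → when c₁ (shift (B b) j))) +
      (∑< K (λ b → when c₁ (C b j)) + ∑< K (λ b → when c₂ (B b j)))
    ≡⟨ cong₂ _+_ (cong₂ _+_ (∑<-shift K A j) (trans (∑<-when K c₁ _) (cong (when c₁) (∑<-shift K B j))))
                 (cong₂ _+_ (∑<-when K c₁ _) (∑<-when K c₂ _)) ⟩
      (shift (λ j → ∑< K (λ b → A b j)) j + when c₁ (shift (λ j → ∑< K (λ b → B b j)) j)) +
      (when c₁ (∑< K (λ b → C b j)) + when c₂ (∑< K (λ b → B b j)))
    ∎
    where open ≡-Reasoning

  ∑<-paths-final≡walks : ∀ K h q j → h + q ≤ K → ∑< K (λ b → paths (suc b) (h + q) q 0 j) ≡ walks h (0 <ᵇ q) 0 j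
  ∑<-paths-final≡walks K zero q zero q≤K =
    trans (∑<-cong K (λ b → cong 𝟙 (∧-idem (suc b ≡ᵇ q)))) (∑<-when-suc≡ᵇ K q 1 q≤K)
  ∑<-paths-final≡walks K (suc h) q zero _ = ∑<-zero K unbalanced
    where
    unbalanced : ∀ b → 𝟙 ((suc b ≡ᵇ suc h + q) ∧ (suc b ≡ᵇ q)) ≡ 0
    unbalanced b with suc b ≡ᵇ q in b≟q
    ... | false = cong 𝟙 (∧-zeroʳ _)
    ... | true rewrite ≢⇒≡ᵇ≡false b (h + q) (λ b≡h+q →
            ℕP.m≢1+n+m q (trans (sym (≡ᵇ≡true⇒≡ (suc b) q b≟q)) (cong suc b≡h+q))) = refl
  ∑<-paths-final≡walks K h q (suc j) _ = ∑<-zero K (λ _ → refl)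

  -- Widths b > h + q + L contribute nothing: no path reaches them.
  ∑<-paths≡walks : ∀ K h q L j → h + q + L ≤ K → ∑< K (λ b → paths (suc b) (h + q) q L j) ≡ walks h (0 <ᵇ q) L j
  ∑<-paths≡walks K h q zero j bound =
    ∑<-paths-final≡walks K h q j (subst (_≤ K) (ℕP.+-identityʳ (h + q)) bound)
  ∑<-paths≡walks K h q (suc L) j bound = begin
      ∑< K (λ b → paths (suc b) (h + q) q (suc L) j)
    ≡⟨ ∑<-cong K (λ b → paths-suc (suc b) (h + q) q L j) ⟩
      _
    ≡⟨ ∑<-moves K (λ b → paths (suc b) (suc h + q) q L) (λ b → paths (suc b) (h + q) q L)
                  (λ b → paths (suc b) (h + q) (suc q) L) (q <ᵇ h + q) (0 <ᵇ q) j ⟩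
      _
    ≡⟨ cong₂ _+_
         (cong₂ _+_ (shift-cong j λ j → ∑<-paths≡walks K (suc h) q L j top-bound)
                    (cong₂ when (q<ᵇh+q≡0<ᵇh h q) (shift-cong j λ j → ∑<-paths≡walks K h q L j stay-bound)))
         (cong₂ _+_ (open-bottom h bound)
                    (cong (when (0 <ᵇ q)) (∑<-paths≡walks K h q L j stay-bound))) ⟩
      walks h (0 <ᵇ q) (suc L) j
    ∎
    where
    open ≡-Reasoning
    top-bound : suc h + q + L ≤ K
    top-bound = subst (_≤ K) (ℕP.+-suc (h + q) L) bound
    stay-bound : h + q + L ≤ K
    stay-bound = ℕP.≤-trans (ℕP.+-monoʳ-≤ (h + q) (ℕP.n≤1+n L)) bound
    open-bottom : ∀ h → h + q + suc L ≤ K →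
      when (q <ᵇ h + q) (∑< K (λ b → paths (suc b) (h + q) (suc q) L j)) ≡ when (0 <ᵇ h) (walks (pred h) true L j)
    open-bottom zero    _     rewrite q<ᵇh+q≡0<ᵇh 0 q = refl
    open-bottom (suc h) bound rewrite q<ᵇh+q≡0<ᵇh (suc h) q =
      trans (cong (λ p → ∑< K (λ b → paths (suc b) p (suc q) L j)) (sym (ℕP.+-suc h q)))
            (∑<-paths≡walks K h (suc q) L j
              (subst (λ t → t + L ≤ K) (sym (ℕP.+-suc h q))
                (ℕP.≤-trans (ℕP.+-monoʳ-≤ (suc h + q) (ℕP.n≤1+n L)) bound)))

module Binomials where

  open import Data.Nat as ℕ using (ℕ; zero; suc)
  open import Data.Nat.Combinatorics using (_C_; nCk+nC[k+1]≡[n+1]C[k+1])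
  open import Data.Integer using (ℤ; +_; _+_; _*_; _-_)
  open import Data.Integer.Properties using (+-comm)
  open import Data.Integer.Tactic.RingSolver using (solve-∀)
  open import Relation.Binary.PropositionalEquality using (_≡_; refl; sym; trans; cong; cong₂; module ≡-Reasoning)

  -- Pascal's rule taken as the definition, so that binomials with a symbolic index reduce.
  binom : ℕ → ℕ → ℕ
  binom zero    zero    = 1
  binom zero    (suc k) = 0
  binom (suc n) zero    = 1
  binom (suc n) (suc k) = binom n k ℕ.+ binom n (suc k)

  binom≡C : ∀ n k → binom n k ≡ n C k
  binom≡C zero    zero    = refl
  binom≡C zero    (suc k) = refl
  binom≡C (suc n) zero    = refl
  binom≡C (suc n) (suc k) =
    trans (cong₂ ℕ._+_ (binom≡C n k) (binom≡C n (suc k))) (nCk+nC[k+1]≡[n+1]C[k+1] n k)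

  C⁺ : ℕ → ℕ → ℤ
  C⁺ n k = + binom n k

  C⁺₋₁ : ℕ → ℕ → ℤ
  C⁺₋₁ n zero    = + 0
  C⁺₋₁ n (suc k) = C⁺ n k

  C⁺[n,0]≡1 : ∀ n → C⁺ n 0 ≡ + 1
  C⁺[n,0]≡1 zero    = refl
  C⁺[n,0]≡1 (suc n) = refl

  C⁺[n,1]≡n : ∀ n → C⁺ n 1 ≡ + n
  C⁺[n,1]≡n zero    = refl
  C⁺[n,1]≡n (suc n) = cong₂ _+_ (C⁺[n,0]≡1 n) (C⁺[n,1]≡n n)

  C⁺-pascal : ∀ n k → C⁺ (suc n) k ≡ C⁺ n k + C⁺₋₁ n k
  C⁺-pascal zero    zero    = refl
  C⁺-pascal (suc n) zero    = refl
  C⁺-pascal n       (suc k) = +-comm (C⁺ n k) (C⁺ n (suc k))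

  [1+k]*C⁺[n,1+k]+k*C⁺[n,k]≡n*C⁺[n,k] : ∀ n k →
    + suc k * C⁺ n (suc k) + + k * C⁺ n k ≡ + n * C⁺ n k
  [1+k]*C⁺[n,1+k]+k*C⁺[n,k]≡n*C⁺[n,k] zero    zero    = refl
  [1+k]*C⁺[n,1+k]+k*C⁺[n,k]≡n*C⁺[n,k] zero    (suc k) =
    ring (+ suc (suc k)) (+ suc k)
    where
    ring : ∀ a b → a * + 0 + b * + 0 ≡ + 0 * + 0
    ring = solve-∀
  [1+k]*C⁺[n,1+k]+k*C⁺[n,k]≡n*C⁺[n,k] (suc n) zero    =
    trans (cong (λ t → + 1 * t + + 0 * + 1) (C⁺[n,1]≡n (suc n))) (ring (+ suc n))
    where
    ring : ∀ x → + 1 * x + + 0 * + 1 ≡ x * + 1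
    ring = solve-∀
  [1+k]*C⁺[n,1+k]+k*C⁺[n,k]≡n*C⁺[n,k] (suc n) (suc k) = begin
      + suc (suc k) * C⁺ (suc n) (suc (suc k)) + + suc k * C⁺ (suc n) (suc k)
    ≡⟨ cong₂ (λ u v → + suc (suc k) * u + + suc k * v) (C⁺-pascal n (suc (suc k))) (C⁺-pascal n (suc k)) ⟩
      (+ 2 + K) * (d + b) + (+ 1 + K) * (b + a)
    ≡⟨ ring₁ K a b d ⟩
      ((+ 2 + K) * d + (+ 1 + K) * b) + ((+ 1 + K) * b + K * a) + b + a
    ≡⟨ cong₂ (λ u v → u + v + b + a) IH₂ IH₁ ⟩
      N * b + N * a + b + a
    ≡⟨ ring₂ N a b ⟩
      (+ 1 + N) * (b + a)
    ≡⟨ cong (+ suc n *_) (sym (C⁺-pascal n (suc k))) ⟩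
      + suc n * C⁺ (suc n) (suc k)
    ∎
    where
    open ≡-Reasoning
    K = + k
    N = + n
    a = C⁺ n k
    b = C⁺ n (suc k)
    d = C⁺ n (suc (suc k))
    IH₁ = [1+k]*C⁺[n,1+k]+k*C⁺[n,k]≡n*C⁺[n,k] n k
    IH₂ = [1+k]*C⁺[n,1+k]+k*C⁺[n,k]≡n*C⁺[n,k] n (suc k)
    ring₁ : ∀ K a b d → (+ 2 + K) * (d + b) + (+ 1 + K) * (b + a) ≡
      ((+ 2 + K) * d + (+ 1 + K) * b) + ((+ 1 + K) * b + K * a) + b + a
    ring₁ = solve-∀
    ring₂ : ∀ N a b → N * b + N * a + b + a ≡ (+ 1 + N) * (b + a)
    ring₂ = solve-∀

  [1+k]*C⁺[1+n,1+k]≡[1+n]*C⁺[n,k] : ∀ n k → + suc k * C⁺ (suc n) (suc k) ≡ + suc n * C⁺ n k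
  [1+k]*C⁺[1+n,1+k]≡[1+n]*C⁺[n,k] n k = begin
      + suc k * C⁺ (suc n) (suc k)
    ≡⟨ ring₁ K a b ⟩
      (+ 1 + K) * a + ((+ 1 + K) * b + K * a) - K * a
    ≡⟨ cong (λ t → (+ 1 + K) * a + t - K * a) ([1+k]*C⁺[n,1+k]+k*C⁺[n,k]≡n*C⁺[n,k] n k) ⟩
      (+ 1 + K) * a + N * a - K * a
    ≡⟨ ring₂ K N a ⟩
      + suc n * a
    ∎
    where
    open ≡-Reasoning
    K = + k
    N = + n
    a = C⁺ n k
    b = C⁺ n (suc k)
    ring₁ : ∀ K a b → (+ 1 + K) * (a + b) ≡ (+ 1 + K) * a + ((+ 1 + K) * b + K * a) - K * a
    ring₁ = solve-∀
    ring₂ : ∀ K N a → (+ 1 + K) * a + N * a - K * a ≡ (+ 1 + N) * a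
    ring₂ = solve-∀

  [1+n]*C⁺[n,k]+k*C⁺[1+n,k]≡[1+n]*C⁺[1+n,k] : ∀ n k →
    + suc n * C⁺ n k + + k * C⁺ (suc n) k ≡ + suc n * C⁺ (suc n) k
  [1+n]*C⁺[n,k]+k*C⁺[1+n,k]≡[1+n]*C⁺[1+n,k] n zero =
    trans (cong (λ t → + suc n * t + + 0 * + 1) (C⁺[n,0]≡1 n)) (ring (+ suc n))
    where
    ring : ∀ x → x * + 1 + + 0 * + 1 ≡ x * + 1
    ring = solve-∀
  [1+n]*C⁺[n,k]+k*C⁺[1+n,k]≡[1+n]*C⁺[1+n,k] n (suc k) =
    trans (cong (λ t → + suc n * C⁺ n (suc k) + t) ([1+k]*C⁺[1+n,1+k]≡[1+n]*C⁺[n,k] n k))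
          (ring (+ n) (C⁺ n k) (C⁺ n (suc k)))
    where
    ring : ∀ N a b → (+ 1 + N) * b + (+ 1 + N) * a ≡ (+ 1 + N) * (a + b)
    ring = solve-∀

module Determinants where

  open Binomials
  open Walks using (walks)
  open import Data.Nat as ℕ using (ℕ; zero; suc)
  import Data.Nat.Properties as ℕP
  open import Data.Bool using (true; false)
  open import Data.Integer using (ℤ; +_; _+_; _*_; _-_)
  open import Data.Integer.Tactic.RingSolver using (solve-∀)
  open import Relation.Binary.PropositionalEquality using (_≡_; refl; sym; trans; cong; cong₂; module ≡-Reasoning)
  open ≡-Reasoning

  -- 2 × 2 determinants of binomial coefficients, as produced by the Lindström–Gessel–Viennot
  -- lemma for pairs of non-crossing lattice paths.
  detA : ℕ → ℕ → ℕ → ℤ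
  detA l j s = C⁺ l j * C⁺ (suc l) s - C⁺₋₁ l j * C⁺ (suc l) (suc s)

  detB : ℕ → ℕ → ℕ → ℤ
  detB l j s = C⁺ l j * C⁺ (suc l) s - C⁺ (suc l) j * C⁺ l s

  detA-suc : ∀ l i s →
    (detA l i (suc s) + detA l i s) + (detA l (suc i) s + detA l (suc i) (suc s)) ≡ detA (suc l) (suc i) (suc s)
  detA-suc l i s = begin
      (x₁ * y₀ - x₂ * y₁ + (x₁ * y₋ - x₂ * y₀)) + ((x₀ * y₋ - x₁ * y₀) + (x₀ * y₀ - x₁ * y₁))
    ≡⟨ ring x₀ x₁ x₂ y₋ y₀ y₁ ⟩
      (x₀ + x₁) * (y₀ + y₋) - (x₁ + x₂) * (y₁ + y₀)
    ≡⟨ sym (cong₂ _-_ (cong₂ _*_ (C⁺-pascal l (suc i)) (C⁺-pascal (suc l) (suc s)))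
                      (cong₂ _*_ (C⁺-pascal l i) (C⁺-pascal (suc l) (suc (suc s))))) ⟩
      detA (suc l) (suc i) (suc s)
    ∎
    where
    x₀ = C⁺ l (suc i)
    x₁ = C⁺ l i
    x₂ = C⁺₋₁ l i
    y₋ = C⁺ (suc l) s
    y₀ = C⁺ (suc l) (suc s)
    y₁ = C⁺ (suc l) (suc (suc s))
    ring : ∀ x₀ x₁ x₂ y₋ y₀ y₁ →
      (x₁ * y₀ - x₂ * y₁ + (x₁ * y₋ - x₂ * y₀)) + ((x₀ * y₋ - x₁ * y₀) + (x₀ * y₀ - x₁ * y₁)) ≡
      (x₀ + x₁) * (y₀ + y₋) - (x₁ + x₂) * (y₁ + y₀)
    ring = solve-∀

  detA-suc-diagonal : ∀ l i → detA l i (suc i) + detA l (suc i) (suc i) ≡ detA (suc l) (suc i) (suc i)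
  detA-suc-diagonal l i = begin
      (x₁ * y₀ - x₂ * y₁) + (x₀ * y₀ - x₁ * y₁)
    ≡⟨ cong (λ y → (x₁ * y - x₂ * y₁) + (x₀ * y - x₁ * y₁)) (C⁺-pascal l (suc i)) ⟩
      (x₁ * (x₀ + x₁) - x₂ * y₁) + (x₀ * (x₀ + x₁) - x₁ * y₁)
    ≡⟨ ring x₀ x₁ x₂ y₁ ⟩
      (x₀ + x₁) * ((x₀ + x₁) + (x₁ + x₂)) - (x₁ + x₂) * (y₁ + (x₀ + x₁))
    ≡⟨ sym (cong₂ _-_
         (cong₂ _*_ (C⁺-pascal l (suc i)) (trans (C⁺-pascal (suc l) (suc i)) (cong₂ _+_ (C⁺-pascal l (suc i)) (C⁺-pascal l i))))
         (cong₂ _*_ (C⁺-pascal l i) (trans (C⁺-pascal (suc l) (suc (suc i))) (cong (λ t → y₁ + t) (C⁺-pascal l (suc i)))))) ⟩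
      detA (suc l) (suc i) (suc i)
    ∎
    where
    x₀ = C⁺ l (suc i)
    x₁ = C⁺ l i
    x₂ = C⁺₋₁ l i
    y₀ = C⁺ (suc l) (suc i)
    y₁ = C⁺ (suc l) (suc (suc i))
    ring : ∀ x₀ x₁ x₂ y₁ →
      (x₁ * (x₀ + x₁) - x₂ * y₁) + (x₀ * (x₀ + x₁) - x₁ * y₁) ≡
      (x₀ + x₁) * ((x₀ + x₁) + (x₁ + x₂)) - (x₁ + x₂) * (y₁ + (x₀ + x₁))
    ring = solve-∀

  detA-suc-first-column : ∀ l s → detA l 0 s + detA l 0 (suc s) ≡ detA (suc l) 0 (suc s)
  detA-suc-first-column l s = begin
      (C⁺ l 0 * y₋ - + 0 * y₀) + (C⁺ l 0 * y₀ - + 0 * y₁)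
    ≡⟨ cong (λ x → (x * y₋ - + 0 * y₀) + (x * y₀ - + 0 * y₁)) (C⁺[n,0]≡1 l) ⟩
      (+ 1 * y₋ - + 0 * y₀) + (+ 1 * y₀ - + 0 * y₁)
    ≡⟨ ring y₋ y₀ y₁ (C⁺ (suc (suc l)) (suc (suc s))) ⟩
      + 1 * (y₀ + y₋) - + 0 * C⁺ (suc (suc l)) (suc (suc s))
    ≡⟨ cong (λ y → + 1 * y - + 0 * C⁺ (suc (suc l)) (suc (suc s))) (sym (C⁺-pascal (suc l) (suc s))) ⟩
      detA (suc l) 0 (suc s)
    ∎
    where
    y₋ = C⁺ (suc l) s
    y₀ = C⁺ (suc l) (suc s)
    y₁ = C⁺ (suc l) (suc (suc s))
    ring : ∀ y₋ y₀ y₁ z → (+ 1 * y₋ - + 0 * y₀) + (+ 1 * y₀ - + 0 * y₁) ≡ + 1 * (y₀ + y₋) - + 0 * z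
    ring = solve-∀

  detA[l,0,0]≡1 : ∀ l → detA l 0 0 ≡ + 1
  detA[l,0,0]≡1 l = cong (λ x → x * + 1 - + 0 * C⁺ (suc l) 1) (C⁺[n,0]≡1 l)

  detB-suc : ∀ l i s →
    (detB l i (suc s) + detB l i s) + detA l (suc i) s ≡ detB (suc l) (suc i) (suc s)
  detB-suc l i s = begin
      (x₁ * C⁺ (suc l) (suc s) - C⁺ (suc l) i * w₀) + (x₁ * C⁺ (suc l) s - C⁺ (suc l) i * w₁) +
      (x₀ * C⁺ (suc l) s - x₁ * C⁺ (suc l) (suc s))
    ≡⟨ cong₂ _+_ (cong₂ _+_ (cong₂ _-_ (cong (x₁ *_) (C⁺-pascal l (suc s))) (cong (_* w₀) (C⁺-pascal l i)))
                            (cong₂ _-_ (cong (x₁ *_) (C⁺-pascal l s)) (cong (_* w₁) (C⁺-pascal l i))))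
                 (cong₂ _-_ (cong (x₀ *_) (C⁺-pascal l s)) (cong (x₁ *_) (C⁺-pascal l (suc s)))) ⟩
      (x₁ * (w₀ + w₁) - (x₁ + x₂) * w₀) + (x₁ * (w₁ + w₂) - (x₁ + x₂) * w₁) + (x₀ * (w₁ + w₂) - x₁ * (w₀ + w₁))
    ≡⟨ ring x₀ x₁ x₂ w₀ w₁ w₂ ⟩
      (x₀ + x₁) * ((w₀ + w₁) + (w₁ + w₂)) - ((x₀ + x₁) + (x₁ + x₂)) * (w₀ + w₁)
    ≡⟨ sym (cong₂ _-_
         (cong₂ _*_ (C⁺-pascal l (suc i)) (trans (C⁺-pascal (suc l) (suc s)) (cong₂ _+_ (C⁺-pascal l (suc s)) (C⁺-pascal l s))))
         (cong₂ _*_ (trans (C⁺-pascal (suc l) (suc i)) (cong₂ _+_ (C⁺-pascal l (suc i)) (C⁺-pascal l i))) (C⁺-pascal l (suc s)))) ⟩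
      detB (suc l) (suc i) (suc s)
    ∎
    where
    x₀ = C⁺ l (suc i)
    x₁ = C⁺ l i
    x₂ = C⁺₋₁ l i
    w₀ = C⁺ l (suc s)
    w₁ = C⁺ l s
    w₂ = C⁺₋₁ l s
    ring : ∀ x₀ x₁ x₂ w₀ w₁ w₂ →
      (x₁ * (w₀ + w₁) - (x₁ + x₂) * w₀) + (x₁ * (w₁ + w₂) - (x₁ + x₂) * w₁) + (x₀ * (w₁ + w₂) - x₁ * (w₀ + w₁)) ≡
      (x₀ + x₁) * ((w₀ + w₁) + (w₁ + w₂)) - ((x₀ + x₁) + (x₁ + x₂)) * (w₀ + w₁)
    ring = solve-∀

  detB-suc-first-column : ∀ l s → detA l 0 s ≡ detB (suc l) 0 (suc s)
  detB-suc-first-column l s = begin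
      C⁺ l 0 * y₋ - + 0 * y₀
    ≡⟨ cong (λ x → x * y₋ - + 0 * y₀) (C⁺[n,0]≡1 l) ⟩
      + 1 * y₋ - + 0 * y₀
    ≡⟨ ring y₀ y₋ ⟩
      + 1 * (y₀ + y₋) - + 1 * y₀
    ≡⟨ cong (λ y → + 1 * y - + 1 * y₀) (sym (C⁺-pascal (suc l) (suc s))) ⟩
      detB (suc l) 0 (suc s)
    ∎
    where
    y₋ = C⁺ (suc l) s
    y₀ = C⁺ (suc l) (suc s)
    ring : ∀ y₀ y₋ → + 1 * y₋ - + 0 * y₀ ≡ + 1 * (y₀ + y₋) - + 1 * y₀
    ring = solve-∀


  walks-true≡detA : ∀ l h j s → j ℕ.+ h ≡ s → + walks h true (suc l) j ≡ detA l j s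
  walks-true≡detA zero zero          zero                .0 refl = refl
  walks-true≡detA zero zero          (suc zero)          .1 refl = refl
  walks-true≡detA zero zero          (suc (suc j))       _  refl = refl
  walks-true≡detA zero (suc zero)    zero                .1 refl = refl
  walks-true≡detA zero (suc zero)    (suc zero)          .2 refl = refl
  walks-true≡detA zero (suc zero)    (suc (suc j))       _  refl = refl
  walks-true≡detA zero (suc (suc h)) zero                _  refl = refl
  walks-true≡detA zero (suc (suc h)) (suc zero)          _  refl = refl
  walks-true≡detA zero (suc (suc h)) (suc (suc j))       _  refl = refl
  walks-true≡detA (suc l) zero zero .0 refl = trans (walks-true≡detA l 0 0 0 refl) (detA[l,0,0]≡1 l)
  walks-true≡detA (suc l) (suc g) zero .(suc g) refl =
    trans (cong₂ _+_ (walks-true≡detA l g 0 g refl) (walks-true≡detA l (suc g) 0 (suc g) refl))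
          (detA-suc-first-column l g)
  walks-true≡detA (suc l) zero (suc i) s refl rewrite ℕP.+-identityʳ i =
    trans (cong +_ (cong (ℕ._+ walks 0 true (suc l) (suc i)) (ℕP.+-identityʳ (walks 1 true (suc l) i))))
    (trans (cong₂ _+_ (walks-true≡detA l 1 i (suc i) (ℕP.+-comm i 1))
                      (walks-true≡detA l 0 (suc i) (suc i) (ℕP.+-identityʳ (suc i))))
           (detA-suc-diagonal l i))
  walks-true≡detA (suc l) (suc g) (suc i) .(suc (i ℕ.+ suc g)) refl =
    trans (cong₂ _+_ (cong₂ _+_ (walks-true≡detA l (suc (suc g)) i _ (ℕP.+-suc i (suc g)))
                                (walks-true≡detA l (suc g) i _ refl))
                     (cong₂ _+_ (walks-true≡detA l g (suc i) _ (sym (ℕP.+-suc i g)))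
                                (walks-true≡detA l (suc g) (suc i) _ refl)))
          (detA-suc l i (i ℕ.+ suc g))

  walks-false≡detB : ∀ l g j s → j ℕ.+ suc g ≡ s → + walks (suc g) false (suc l) j ≡ detB l j s
  walks-false≡detB zero zero    zero          .1 refl = refl
  walks-false≡detB zero zero    (suc zero)    _  refl = refl
  walks-false≡detB zero zero    (suc (suc j)) _  refl = refl
  walks-false≡detB zero (suc g) zero          _  refl = refl
  walks-false≡detB zero (suc g) (suc zero)    _  refl = refl
  walks-false≡detB zero (suc g) (suc (suc j)) _  refl = refl
  walks-false≡detB (suc l) g zero .(suc g) refl =
    trans (cong +_ (ℕP.+-identityʳ (walks g true (suc l) 0)))
    (trans (walks-true≡detA l g 0 g refl) (detB-suc-first-column l g))
  walks-false≡detB (suc l) g (suc i) .(suc (i ℕ.+ suc g)) refl =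
    trans (cong (λ t → + (walks (suc (suc g)) false (suc l) i ℕ.+ walks (suc g) false (suc l) i ℕ.+ t))
                (ℕP.+-identityʳ (walks g true (suc l) (suc i))))
    (trans (cong₂ _+_ (cong₂ _+_ (walks-false≡detB l (suc g) i _ (ℕP.+-suc i (suc g)))
                                 (walks-false≡detB l g i _ refl))
                      (walks-true≡detA l g (suc i) _ (sym (ℕP.+-suc i g))))
           (detB-suc l i (i ℕ.+ suc g)))

  [1+j]*detB[l,j,1+j]≡C⁺[1+l,j]*C⁺[l,j] : ∀ l j → + suc j * detB l j (suc j) ≡ C⁺ (suc l) j * C⁺ l j
  [1+j]*detB[l,j,1+j]≡C⁺[1+l,j]*C⁺[l,j] l j = begin
      (+ 1 + J) * (a * e - b * f)
    ≡⟨ ring₁ J a b e f ⟩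
      a * ((+ 1 + J) * e) - b * ((+ 1 + J) * f)
    ≡⟨ cong (λ t → a * t - b * ((+ 1 + J) * f)) ([1+k]*C⁺[1+n,1+k]≡[1+n]*C⁺[n,k] l j) ⟩
      a * ((+ 1 + L) * a) - b * ((+ 1 + J) * f)
    ≡⟨ ring₂ J L a b f ⟩
      a * ((+ 1 + L) * a + J * b) - b * ((+ 1 + J) * f + J * a)
    ≡⟨ cong₂ (λ u v → a * u - b * v) ([1+n]*C⁺[n,k]+k*C⁺[1+n,k]≡[1+n]*C⁺[1+n,k] l j)
                                     ([1+k]*C⁺[n,1+k]+k*C⁺[n,k]≡n*C⁺[n,k] l j) ⟩
      a * ((+ 1 + L) * b) - b * (L * a)
    ≡⟨ ring₃ L a b ⟩
      b * a
    ∎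
    where
    J = + j
    L = + l
    a = C⁺ l j
    b = C⁺ (suc l) j
    e = C⁺ (suc l) (suc j)
    f = C⁺ l (suc j)
    ring₁ : ∀ J a b e f → (+ 1 + J) * (a * e - b * f) ≡ a * ((+ 1 + J) * e) - b * ((+ 1 + J) * f)
    ring₁ = solve-∀
    ring₂ : ∀ J L a b f → a * ((+ 1 + L) * a) - b * ((+ 1 + J) * f) ≡
      a * ((+ 1 + L) * a + J * b) - b * ((+ 1 + J) * f + J * a)
    ring₂ = solve-∀
    ring₃ : ∀ L a b → a * ((+ 1 + L) * b) - b * (L * a) ≡ b * a
    ring₃ = solve-∀

open import Defs
open import Data.Nat using (ℕ; suc; _+_; _*_; _≤_; _<_; _∸_; z≤n; s≤s; _≤?_)
import Data.Nat.Properties as ℕP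
open import Data.Nat.Combinatorics using (_C_)
open import Data.Nat.ListAction using (sum)
open import Data.Bool using (false)
open import Data.List using (map; upTo)
open import Data.List.Properties using (map-∘; map-applyUpTo)
import Data.Integer as ℤ
import Data.Integer.Properties as ℤP
open import Relation.Binary.PropositionalEquality using (_≡_; sym; trans; cong; cong₂; subst₂; module ≡-Reasoning)
open import Relation.Nullary using (¬_)
open Sums using (∑<; ∑<-cong; sum-map-filter)
open Counting using (paths; countShape≡accepted; accepted≡paths)
open Walks using (walks; paths-short≡0; ∑<-paths≡walks)
open Binomials using (binom; binom≡C; C⁺)
open Determinants using (detB; walks-false≡detB; [1+j]*detB[l,j,1+j]≡C⁺[1+l,j]*C⁺[l,j])

countShape≡paths : ∀ b n m → countShape b n m ≡ paths b 0 0 n m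
countShape≡paths b n m = trans (countShape≡accepted b n m) (accepted≡paths b 0 0 n m z≤n z≤n)

first-entry-opens-top : ∀ L j → walks 0 false (suc L) (suc j) ≡ walks 1 false L j
first-entry-opens-top L j = trans (ℕP.+-identityʳ _) (ℕP.+-identityʳ (walks 1 false L j))

countAll≡walks : ∀ n m → countAll n m ≡ walks 0 false n m
countAll≡walks n m = begin
    countAll n m
  ≡⟨ sum-map-filter (λ b → 2 * b ≤? n) (λ b → countShape b n m) (map suc (upTo n)) too-wide ⟩
    sum (map (λ b → countShape b n m) (map suc (upTo n)))
  ≡⟨ cong sum (trans (sym (map-∘ (upTo n))) (map-applyUpTo (λ b → b) _ n)) ⟩
    ∑< n (λ b → countShape (suc b) n m)
  ≡⟨ ∑<-cong n (λ b → countShape≡paths (suc b) n m) ⟩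
    ∑< n (λ b → paths (suc b) 0 0 n m)
  ≡⟨ ∑<-paths≡walks n 0 0 n m ℕP.≤-refl ⟩
    walks 0 false n m
  ∎
  where
  open ≡-Reasoning
  too-wide : ∀ b → ¬ 2 * b ≤ n → countShape b n m ≡ 0
  too-wide b 2b≰n = trans (countShape≡paths b n m) (paths-short≡0 b 0 0 n m
    (subst₂ _<_ (sym (ℕP.+-identityʳ n)) (cong (b +_) (ℕP.+-identityʳ b)) (ℕP.≰⇒> 2b≰n)))

corollary8 : (n m : ℕ) → 2 ≤ n → 1 ≤ m →
    m * countAll n m ≡ ((n ∸ 1) C (m ∸ 1)) * ((n ∸ 2) C (m ∸ 1))
corollary8 (suc (suc l)) (suc j) (s≤s (s≤s z≤n)) (s≤s z≤n) = ℤP.+-injective (begin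
    ℤ.+ (suc j * countAll (suc (suc l)) (suc j))
  ≡⟨ ℤP.pos-* (suc j) _ ⟩
    ℤ.+ suc j ℤ.* ℤ.+ countAll (suc (suc l)) (suc j)
  ≡⟨ cong (λ c → ℤ.+ suc j ℤ.* ℤ.+ c) (trans (countAll≡walks (suc (suc l)) (suc j)) (first-entry-opens-top (suc l) j)) ⟩
    ℤ.+ suc j ℤ.* ℤ.+ walks 1 false (suc l) j
  ≡⟨ cong (ℤ.+ suc j ℤ.*_) (walks-false≡detB l 0 j (suc j) (ℕP.+-comm j 1)) ⟩
    ℤ.+ suc j ℤ.* detB l j (suc j)
  ≡⟨ [1+j]*detB[l,j,1+j]≡C⁺[1+l,j]*C⁺[l,j] l j ⟩
    C⁺ (suc l) j ℤ.* C⁺ l j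
  ≡⟨ sym (ℤP.pos-* (binom (suc l) j) (binom l j)) ⟩
    ℤ.+ (binom (suc l) j * binom l j)
  ≡⟨ cong ℤ.+_ (cong₂ _*_ (binom≡C (suc l) j) (binom≡C l j)) ⟩
    ℤ.+ ((suc l C j) * (l C j))
  ∎)
  where open ≡-Reasoning
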